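{- Let $\Upsilon=(\Gamma,\sigma,\varphi)$ be a gain signed graph with orientation $\tau$ and let $T\subseteq E$ be a pseudoforest. Then there is a gain switcher $\theta:V\to\mathbb{K}$ such that $\varphi^\theta(e)=0$ for all $e\in T$. For connected $T$ with an arbitrarily fixed root vertex $r$ of $T$, such a switcher (on the vertices of $T$) is given by $$\theta(v):=\sigma(T_{rv})\big[\theta_0-\varphi(T_{rv})\big],$$ where $\theta_0\in\mathbb{K}$ is arbitrary if $T$ is a tree, and $\theta_0=\varphi(T_{re})$ if $T$ has a half edge $e$.
   Context: Let $\mathbb{K}$ be a field of characteristic $\ne2$. A graph $\Gamma=(V,E)$ has vertex set $V=\{v_1,\dots,v_n\}$ and finite edge set $E$; edges are links (two ends at distinct vertices), loops (two ends at one vertex), half edges (one end) or loose edges (no ends); parallel edges allowed. A gain signed graph $\Upsilon=(\Gamma,\sigma,\varphi)$: $\sigma:E\to\{\pm1\}$ (half edges negative, loose edges positive); with an orientation $\tau$ (signs $\tau(v,e)\in\{\pm1\}$ on edge ends, $\tau(v,e)\tau(w,e)=-\sigma(e)$ for a link or loop with ends $v,w$) each edge has gain $\varphi(e)\in\mathbb{K}$, negated on reorientation. Walk gain of $W=u_0e_1\cdots e_lu_l$: $\sigma(W)=\prod\sigma(e_i)$, $\varphi(W)=-\sum_{i=1}^l\varphi(e_i)\sigma(W_{0,i-1})\tau(u_{i-1},e_i)$ with $W_{0,j}=u_0e_1\cdots e_ju_j$. An ultrawalk ending with a half edge $e_{l+1}$ at $u_l$ has gain $\varphi(W_{0,l})-\varphi(e_{l+1})\sigma(W_{0,l})\tau(u_l,e_{l+1})$.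 Gain switching by $\theta:V\to\mathbb{K}$: $\varphi^\theta(e)=\tau(v,e)\theta(v)+\varphi(e)+\tau(w,e)\theta(w)$ for a link or loop with ends $v,w$; $\tau(v,e)\theta(v)+\varphi(e)$ for a half edge at $v$; $\varphi(e)$ for a loose edge. A pseudotree is a tree or a tree with one attached half edge; a pseudoforest is an edge set whose components are pseudotrees. For a connected pseudotree $T$ with root $r$ and a vertex $v$ of $T$, $T_{rv}$ is the path in $T$ from $r$ to $v$ (as a walk); if $T$ has a half edge $e$ at vertex $w$, $T_{re}$ is the ultrawalk consisting of $T_{rw}$ followed by $e$. -}

module Defs where

open import Level using (Level; _⊔_; suc)
open import Algebra.Bundles using (CommutativeRing)
open import Data.Nat using (ℕ)
import Data.Nat as ℕ
open import Data.Fin using (Fin)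
open import Data.Fin.Subset using (Subset; _∈_)
open import Data.Sign as S using (Sign) renaming (_*_ to _·_; opposite to neg)
open import Data.Product using (Σ; _×_; ∃; ∃-syntax; _,_)
open import Data.Sum using (_⊎_)
open import Data.List using (List; []; _∷_)
open import Data.List.Relation.Unary.Unique.Propositional using (Unique)
open import Relation.Binary.PropositionalEquality using (_≡_; _≢_)
open import Relation.Nullary using (¬_)
open import Data.Unit using (⊤)
open import Data.Empty using (⊥)

record Field (c ℓ : Level) : Set (suc (c ⊔ ℓ)) where
  field
    commRing : CommutativeRing c ℓ
  open CommutativeRing commRing public
  field
    1≉0     : ¬ (1# ≈ 0#)
    inverse : ∀ x → ¬ (x ≈ 0#) → Σ Carrier (λ y → x * y ≈ 1#)

CharNot2 : ∀ {c ℓ} → Field c ℓ → Set ℓ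
CharNot2 F = ¬ ((1# + 1#) ≈ 0#) where open Field F

-- Ends of an edge, together with the orientation τ on its ends.
--   twoEnd v t w t' : a link (v ≢ w) or a loop (v ≡ w) with ends at v and
--                     w, τ-sign t on the end at v and t' on the end at w
--   half v t        : a half edge with its single end at v, τ-sign t
--   loose           : a loose edge (no ends)

data Ends (n : ℕ) : Set where
  twoEnd : (v : Fin n) (t : Sign) (w : Fin n) (t' : Sign) → Ends n
  half   : (v : Fin n) (t : Sign) → Ends n
  loose  : Ends n

record GainSignedGraph {c ℓ} (F : Field c ℓ) (n m : ℕ) : Set c where
  open Field F
  field
    ends : Fin m → Ends n
    σ    : Fin m → Sign
    φ    : Fin m → Carrier         -- gain (w.r.t. the orientation τ)
    σ-half  : ∀ e v t → ends e ≡ half v t → σ e ≡ S.-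
    σ-loose : ∀ e → ends e ≡ loose → σ e ≡ S.+
    τ-two   : ∀ e v t w t' → ends e ≡ twoEnd v t w t' → t · t' ≡ neg (σ e)

module GSG {c ℓ} {F : Field c ℓ} {n m : ℕ} (G : GainSignedGraph F n m) where
  open Field F
  open GainSignedGraph G

  ⟦_⟧ : Sign → Carrier
  ⟦ S.+ ⟧ = 1#
  ⟦ S.- ⟧ = - 1#

  -- Traversing edge e from vertex u to vertex u' (e must be a link or loop);
  -- the first Sign argument is τ(u,e), the sign of the end we leave from.
  data Step (e : Fin m) (u u' : Fin n) : Set where
    fwd : (t t' : Sign) → ends e ≡ twoEnd u t u' t' → Step e u u'
    bwd : (t t' : Sign) → ends e ≡ twoEnd u' t' u t → Step e u u'

  exitSign : ∀ {e u u'} → Step e u u' → Sign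
  exitSign (fwd t _ _) = t
  exitSign (bwd t _ _) = t

  data Walk : Fin n → Fin n → Set where
    [] : ∀ {u} → Walk u u
    _∷⟨_⟩_ : ∀ {u u' w} (e : Fin m) → Step e u u' → Walk u' w → Walk u w

  edgesOf : ∀ {u w} → Walk u w → List (Fin m)
  edgesOf [] = []
  edgesOf (e ∷⟨ _ ⟩ W) = e ∷ edgesOf W

  verticesOf : ∀ {u w} → Walk u w → List (Fin n)
  verticesOf {u} [] = u ∷ []
  verticesOf {u} (e ∷⟨ _ ⟩ W) = u ∷ verticesOf W

  length : ∀ {u w} → Walk u w → ℕ
  length [] = 0
  length (_ ∷⟨ _ ⟩ W) = ℕ.suc (length W)

  sgn : ∀ {u w} → Walk u w → Sign
  sgn [] = S.+
  sgn (e ∷⟨ _ ⟩ W) = σ e · sgn W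

  -- φ(W) = - Σᵢ φ(eᵢ) σ(W_{0,i-1}) τ(u_{i-1},eᵢ); the first argument s is
  -- the running sign σ(W_{0,i-1}) of the prefix already traversed.
  gainFrom : ∀ {u w} → Sign → Walk u w → Carrier
  gainFrom s [] = 0#
  gainFrom s (e ∷⟨ st ⟩ W) =
    (- (φ e * ⟦ s ⟧ * ⟦ exitSign st ⟧)) + gainFrom (s · σ e) W

  gain : ∀ {u w} → Walk u w → Carrier
  gain W = gainFrom S.+ W

  -- gain of the ultrawalk W followed by a half edge e at the end of W,
  -- where t = τ(u_l, e)
  ultraGain : ∀ {u w} → Walk u w → (e : Fin m) → (t : Sign) → Carrier
  ultraGain W e t = gain W - (φ e * ⟦ sgn W ⟧ * ⟦ t ⟧)

  switched : (Fin n → Carrier) → Fin m → Carrier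
  switched θ e with ends e
  ... | twoEnd v t w t' = (⟦ t ⟧ * θ v + φ e) + ⟦ t' ⟧ * θ w
  ... | half v t        = ⟦ t ⟧ * θ v + φ e
  ... | loose           = φ e

  module _ (T : Subset m) where

    WalkIn : ∀ {u w} → Walk u w → Set
    WalkIn [] = ⊤
    WalkIn (e ∷⟨ _ ⟩ W) = (e ∈ T) × WalkIn W

    IsPathIn : ∀ {u w} → Walk u w → Set
    IsPathIn W = WalkIn W × Unique (verticesOf W)

    -- a cycle in T: a closed walk of positive length in T with pairwise
    -- distinct edges and pairwise distinct vertices u₀,…,u_{l-1}
    IsCycleIn : ∀ {u} → Walk u u → Set
    IsCycleIn [] = ⊥
    IsCycleIn {u} (e ∷⟨ st ⟩ W) =
      WalkIn (e ∷⟨ st ⟩ W) × Unique (e ∷ edgesOf W) × Unique (verticesOf W)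

    VertexOf : Fin n → Set
    VertexOf v = ∃[ e ] (e ∈ T) × (  (∃[ t ] ∃[ w ] ∃[ t' ] ends e ≡ twoEnd v t w t')
                                   ⊎ (∃[ t ] ∃[ w ] ∃[ t' ] ends e ≡ twoEnd w t' v t)
                                   ⊎ (∃[ t ] ends e ≡ half v t))

    IsLink : Fin m → Set
    IsLink e = ∃[ v ] ∃[ t ] ∃[ w ] ∃[ t' ] (ends e ≡ twoEnd v t w t') × (v ≢ w)

    IsHalf : Fin m → Set
    IsHalf e = ∃[ v ] ∃[ t ] ends e ≡ half v t

    Connected : Set
    Connected = ∀ u w → VertexOf u → VertexOf w → ∃[ W ] WalkIn {u} {w} W

    -- pseudoforest: every component is a tree or a tree with one half edge,
    -- i.e. all edges of T are links or half edges, T has no cycle, and two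
    -- half edges of T in the same component coincide.
    IsPseudoforest : Set
    IsPseudoforest =
        (∀ e → e ∈ T → IsLink e ⊎ IsHalf e)
      × (∀ u (W : Walk u u) → ¬ IsCycleIn W)
      × (∀ e f v t w t' → e ∈ T → f ∈ T → ends e ≡ half v t → ends f ≡ half w t'
           → (∃[ W ] WalkIn {v} {w} W) → e ≡ f)

{-# OPTIONS --safe #-}
-- Along a walk W from r, the value σ(W)[θ₀ − φ(W)] at the far end of an edge is exactly the
-- value that makes that edge's switched gain vanish, given the value at its near end. Every
-- link of a connected pseudotree is the last edge of a path from r, and the choice of θ₀
-- handles the half edge; this gives the explicit switcher. For an arbitrary pseudoforest T,
-- remove a leaf edge e (one with an end v met by no other edge of T), switch T − e to zero by
-- induction, and choose θ(v) to kill e. Leaves exist: otherwise a path could be extended at its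
-- head forever, since T has no cycle and a half edge met at the head would be a second half
-- edge in the component of the one (if any) at the path's start.
module Submission where

open import Defs
open import Data.Nat as ℕ using (ℕ; zero; suc; _<_; _≤_; s≤s)
import Data.Nat.Properties as ℕ
open import Data.Fin using (Fin; _≟_)
open import Data.Fin.Properties using (any?; all?; injective⇒≤)
open import Data.Fin.Subset using (Subset; _∈_; _⊆_; ⁅_⁆; ∣_∣) renaming (_-_ to _∖_)
open import Data.Fin.Subset.Properties using (_∈?_; ∣p∣≤n; p─q⊆p; x∈p⇒∣p-x∣<∣p∣; x∈p∧x≢y⇒x∈p-y)
open import Data.Product using (Σ; _×_; ∃-syntax; ∃₂; _,_; proj₁; proj₂)
open import Data.Sum using (_⊎_; inj₁; inj₂)
open import Data.Unit using (tt)
open import Data.Empty using (⊥; ⊥-elim)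
open import Data.Sign as S using (Sign) renaming (_*_ to _·_; opposite to neg)
import Data.Sign.Properties as Sign
open import Data.List as L using (List; []; _∷_)
open import Data.List.Membership.Propositional using () renaming (_∈_ to _∈ₗ_; _∉_ to _∉ₗ_)
open import Data.List.Membership.Propositional.Properties using (∈-lookup)
open import Data.List.Relation.Binary.Subset.Propositional using () renaming (_⊆_ to _⊆ₗ_)
open import Data.List.Relation.Unary.Any using (here; there)
open import Data.List.Relation.Unary.All as All using ([]; _∷_)
open import Data.List.Relation.Unary.All.Properties using (¬Any⇒All¬; anti-mono)
open import Data.List.Relation.Unary.AllPairs using ([]; _∷_)
open import Data.List.Relation.Unary.Unique.Propositional using (Unique)
open import Data.List.Relation.Unary.Unique.Propositional.Properties using () renaming (++⁺ to Unique-++⁺)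
open import Data.Vec.Functional using (updateAt)
open import Data.Vec.Functional.Properties using (updateAt-updates; updateAt-minimal)
open import Function using (const; Injective)
open import Relation.Binary.PropositionalEquality as ≡ using (_≡_; _≢_; refl; cong; subst)
open import Relation.Nullary using (Dec; yes; no)
open import Relation.Nullary.Decidable using (_×-dec_; _→-dec_; ¬?; decidable-stable)

lookup-injective : ∀ {a} {A : Set a} {xs : List A} → Unique xs → Injective _≡_ _≡_ (L.lookup xs)
lookup-injective (_ ∷ _)   {Fin.zero}  {Fin.zero}  _  = refl
lookup-injective (x∉ ∷ _)  {Fin.zero}  {Fin.suc j} eq = ⊥-elim (All.lookup x∉ (∈-lookup j) eq)
lookup-injective (x∉ ∷ _)  {Fin.suc i} {Fin.zero}  eq = ⊥-elim (All.lookup x∉ (∈-lookup i) (≡.sym eq))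
lookup-injective (_ ∷ xs!) {Fin.suc i} {Fin.suc j} eq = cong Fin.suc (lookup-injective xs! eq)

unique⇒length≤ : ∀ {k} {xs : List (Fin k)} → Unique xs → L.length xs ≤ k
unique⇒length≤ xs! = injective⇒≤ (lookup-injective xs!)

opposite-of-product : ∀ t t' q → t · t' ≡ neg q → t' ≡ neg (t · q)
opposite-of-product S.+ S.+ S.- refl = refl
opposite-of-product S.+ S.- S.+ refl = refl
opposite-of-product S.- S.+ S.+ refl = refl
opposite-of-product S.- S.- S.- refl = refl
opposite-of-product S.+ S.+ S.+ ()
opposite-of-product S.+ S.- S.- ()
opposite-of-product S.- S.+ S.- ()
opposite-of-product S.- S.- S.+ ()

module GainSwitching {c ℓ} {F : Field c ℓ} {n m : ℕ} (G : GainSignedGraph F n m) where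
  open Field F renaming (refl to ≈-refl; sym to ≈-sym; trans to ≈-trans)
  open GSG G hiding (length)
  open GainSignedGraph G
  open import Algebra.Properties.Ring ring using (-1*x≈-x; -‿distribʳ-*; -‿involutive; -‿+-comm; xyx⁻¹≈y)
  open import Algebra.Properties.CommutativeSemigroup *-commutativeSemigroup using (xy∙z≈y∙zx)
  open import Relation.Binary.Reasoning.Setoid setoid
  open import Data.List.Membership.DecPropositional (_≟_ {n}) using () renaming (_∈?_ to _∈?ₗ_)

  infixr 7 _⊙_
  _⊙_ : Sign → Carrier → Carrier
  s ⊙ x = ⟦ s ⟧ * x

  neg-⊙ : ∀ s x → neg s ⊙ x ≈ - (s ⊙ x)
  neg-⊙ S.+ x = ≈-trans (-1*x≈-x x) (-‿cong (≈-sym (*-identityˡ x)))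
  neg-⊙ S.- x = ≈-trans (*-identityˡ x) (≈-sym (≈-trans (-‿cong (-1*x≈-x x)) (-‿involutive x)))

  ⊙-· : ∀ s s' x → (s · s') ⊙ x ≈ s ⊙ s' ⊙ x
  ⊙-· S.+ s' x = ≈-sym (*-identityˡ _)
  ⊙-· S.- s' x = ≈-trans (neg-⊙ s' x) (≈-sym (-1*x≈-x _))

  ⊙-cancel : ∀ s x → s ⊙ s ⊙ x ≈ x
  ⊙-cancel s x = begin
    s ⊙ s ⊙ x    ≈⟨ ⊙-· s s x ⟨
    (s · s) ⊙ x  ≡⟨ cong (_⊙ x) (Sign.s*s≡+ s) ⟩
    1# * x       ≈⟨ *-identityˡ x ⟩
    x            ∎

  ⊙-neg : ∀ s x → s ⊙ - x ≈ - (s ⊙ x)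
  ⊙-neg s x = ≈-sym (-‿distribʳ-* ⟦ s ⟧ x)

  ⊙-neg-cancel : ∀ s x → s ⊙ - (s ⊙ x) ≈ - x
  ⊙-neg-cancel s x = ≈-trans (⊙-neg s (s ⊙ x)) (-‿cong (⊙-cancel s x))

  *-signs : ∀ x s t → x * ⟦ s ⟧ * ⟦ t ⟧ ≈ s ⊙ t ⊙ x
  *-signs x s t = xy∙z≈y∙zx x ⟦ s ⟧ ⟦ t ⟧

  x-[y-z]≈x-y+z : ∀ x y z → x - (y - z) ≈ (x - y) + z
  x-[y-z]≈x-y+z x y z = begin
    x + - (y + - z)    ≈⟨ +-congˡ (-‿+-comm y (- z)) ⟨
    x + (- y + - - z)  ≈⟨ +-congˡ (+-congˡ (-‿involutive z)) ⟩
    x + (- y + z)      ≈⟨ +-assoc x (- y) z ⟨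
    (x - y) + z        ∎

  entrySign : ∀ {e u u'} → Step e u u' → Sign
  entrySign (fwd _ t' _) = t'
  entrySign (bwd _ t' _) = t'

  entrySign-opposite : ∀ {e u u'} (st : Step e u u') → entrySign st ≡ neg (exitSign st · σ e)
  entrySign-opposite {e} {u} {u'} (fwd t t' eq) = opposite-of-product t t' (σ e) (τ-two e u t u' t' eq)
  entrySign-opposite {e} {u} {u'} (bwd t t' eq) =
    opposite-of-product t t' (σ e) (≡.trans (Sign.*-comm t t') (τ-two e u' t' u t eq))

  switched-half : ∀ θ {e v t} → ends e ≡ half v t → switched θ e ≡ t ⊙ θ v + φ e
  switched-half θ {e} eq with ends e
  switched-half θ refl | _ = refl

  switched-step : ∀ θ {e u u'} (st : Step e u u') →
    switched θ e ≈ (exitSign st ⊙ θ u + φ e) + entrySign st ⊙ θ u'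
  switched-step θ {e} (fwd t t' eq) with ends e
  switched-step θ (fwd t t' refl) | _ = ≈-refl
  switched-step θ {e} {u} {u'} (bwd t t' eq) with ends e
  switched-step θ {e} {u} {u'} (bwd t t' refl) | _ = begin
    (t' ⊙ θ u' + φ e) + t ⊙ θ u  ≈⟨ +-assoc _ _ _ ⟩
    t' ⊙ θ u' + (φ e + t ⊙ θ u)  ≈⟨ +-comm _ _ ⟩
    (φ e + t ⊙ θ u) + t' ⊙ θ u'  ≈⟨ +-congʳ (+-comm _ _) ⟩
    (t ⊙ θ u + φ e) + t' ⊙ θ u'  ∎

  vanishes-at-half : ∀ θ {e v t} → ends e ≡ half v t → θ v ≈ - (t ⊙ φ e) → switched θ e ≈ 0#
  vanishes-at-half θ {e} {v} {t} eq θv = begin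
    switched θ e       ≡⟨ switched-half θ eq ⟩
    t ⊙ θ v + φ e      ≈⟨ +-congʳ (*-congˡ θv) ⟩
    t ⊙ - (t ⊙ φ e) + φ e  ≈⟨ +-congʳ (⊙-neg-cancel t (φ e)) ⟩
    - φ e + φ e        ≈⟨ -‿inverseˡ (φ e) ⟩
    0#                 ∎

  vanishes-across : ∀ θ {e u u'} (st : Step e u u') →
    θ u' ≈ - (entrySign st ⊙ (exitSign st ⊙ θ u + φ e)) → switched θ e ≈ 0#
  vanishes-across θ {e} {u} {u'} st θu' = begin
    switched θ e                           ≈⟨ switched-step θ st ⟩
    A + entrySign st ⊙ θ u'                ≈⟨ +-congˡ (*-congˡ θu') ⟩
    A + entrySign st ⊙ - (entrySign st ⊙ A) ≈⟨ +-congˡ (⊙-neg-cancel (entrySign st) A) ⟩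
    A - A                                  ≈⟨ -‿inverseʳ A ⟩
    0#                                     ∎
    where A = exitSign st ⊙ θ u + φ e

  infixl 5 _∷ʳ_
  _∷ʳ_ : ∀ {u w w' e} → Walk u w → Step e w w' → Walk u w'
  [] ∷ʳ st = _ ∷⟨ st ⟩ []
  (e ∷⟨ st' ⟩ W) ∷ʳ st = e ∷⟨ st' ⟩ (W ∷ʳ st)

  verticesOf-∷ʳ : ∀ {u w w' e} (W : Walk u w) (st : Step e w w') →
    verticesOf (W ∷ʳ st) ≡ verticesOf W L.∷ʳ w'
  verticesOf-∷ʳ [] st = refl
  verticesOf-∷ʳ (e ∷⟨ _ ⟩ W) st = cong (_ ∷_) (verticesOf-∷ʳ W st)

  sgn-∷ʳ : ∀ {u w w' e} (W : Walk u w) (st : Step e w w') → sgn (W ∷ʳ st) ≡ sgn W · σ e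
  sgn-∷ʳ {e = e} [] st = Sign.*-identityʳ (σ e)
  sgn-∷ʳ {e = e} (e' ∷⟨ _ ⟩ W) st =
    ≡.trans (cong (σ e' ·_) (sgn-∷ʳ W st)) (≡.sym (Sign.*-assoc (σ e') (sgn W) (σ e)))

  gainFrom-∷ʳ : ∀ s {u w w' e} (W : Walk u w) (st : Step e w w') →
    gainFrom s (W ∷ʳ st) ≈ gainFrom s W - φ e * ⟦ s · sgn W ⟧ * ⟦ exitSign st ⟧
  gainFrom-∷ʳ s {e = e} [] st = begin
    - (φ e * ⟦ s ⟧ * ⟦ exitSign st ⟧) + 0#        ≈⟨ +-identityʳ _ ⟩
    - (φ e * ⟦ s ⟧ * ⟦ exitSign st ⟧)             ≡⟨ cong (λ s' → - (φ e * ⟦ s' ⟧ * ⟦ exitSign st ⟧)) (≡.sym (Sign.*-identityʳ s)) ⟩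
    - (φ e * ⟦ s · S.+ ⟧ * ⟦ exitSign st ⟧)       ≈⟨ +-identityˡ _ ⟨
    0# - φ e * ⟦ s · S.+ ⟧ * ⟦ exitSign st ⟧      ∎
  gainFrom-∷ʳ s {e = e} (e' ∷⟨ st' ⟩ W) st = begin
    a + gainFrom (s · σ e') (W ∷ʳ st)                                  ≈⟨ +-congˡ (gainFrom-∷ʳ (s · σ e') W st) ⟩
    a + (gainFrom (s · σ e') W - φ e * ⟦ (s · σ e') · sgn W ⟧ * t)     ≈⟨ +-assoc _ _ _ ⟨
    (a + gainFrom (s · σ e') W) - φ e * ⟦ (s · σ e') · sgn W ⟧ * t     ≡⟨ cong (λ s' → (a + gainFrom (s · σ e') W) - φ e * ⟦ s' ⟧ * t) (Sign.*-assoc s (σ e') (sgn W)) ⟩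
    (a + gainFrom (s · σ e') W) - φ e * ⟦ s · (σ e' · sgn W) ⟧ * t     ∎
    where
    a = - (φ e' * ⟦ s ⟧ * ⟦ exitSign st' ⟧)
    t = ⟦ exitSign st ⟧

  gain-∷ʳ : ∀ {u w w' e} (W : Walk u w) (st : Step e w w') →
    gain (W ∷ʳ st) ≈ gain W - sgn W ⊙ exitSign st ⊙ φ e
  gain-∷ʳ {e = e} W st =
    ≈-trans (gainFrom-∷ʳ S.+ W st) (+-congˡ (-‿cong (*-signs (φ e) (sgn W) (exitSign st))))

  potential : ∀ {u w} → Carrier → Walk u w → Carrier
  potential θ₀ W = sgn W ⊙ (θ₀ - gain W)

  potential-∷ʳ : ∀ θ₀ {u w w' e} (W : Walk u w) (st : Step e w w') →
    potential θ₀ (W ∷ʳ st) ≈ - (entrySign st ⊙ (exitSign st ⊙ potential θ₀ W + φ e))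
  potential-∷ʳ θ₀ {e = e} W st = ≈-trans lhs (≈-sym rhs)
    where
    s = sgn W
    q = σ e
    t = exitSign st
    X = θ₀ - gain W
    common = q ⊙ (s ⊙ X + t ⊙ φ e)
    lhs : potential θ₀ (W ∷ʳ st) ≈ common
    lhs = begin
      sgn (W ∷ʳ st) ⊙ (θ₀ - gain (W ∷ʳ st))  ≡⟨ cong (λ s' → s' ⊙ (θ₀ - gain (W ∷ʳ st))) (≡.trans (sgn-∷ʳ W st) (Sign.*-comm s q)) ⟩
      (q · s) ⊙ (θ₀ - gain (W ∷ʳ st))        ≈⟨ *-congˡ (+-congˡ (-‿cong (gain-∷ʳ W st))) ⟩
      (q · s) ⊙ (θ₀ - (gain W - s ⊙ t ⊙ φ e)) ≈⟨ *-congˡ (x-[y-z]≈x-y+z θ₀ (gain W) _) ⟩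
      (q · s) ⊙ (X + s ⊙ t ⊙ φ e)            ≈⟨ ⊙-· q s _ ⟩
      q ⊙ s ⊙ (X + s ⊙ t ⊙ φ e)              ≈⟨ *-congˡ (distribˡ ⟦ s ⟧ X _) ⟩
      q ⊙ (s ⊙ X + s ⊙ s ⊙ t ⊙ φ e)          ≈⟨ *-congˡ (+-congˡ (⊙-cancel s _)) ⟩
      common                                 ∎
    rhs : - (entrySign st ⊙ (t ⊙ potential θ₀ W + φ e)) ≈ common
    rhs = begin
      - (entrySign st ⊙ (t ⊙ s ⊙ X + φ e))   ≡⟨ cong (λ s' → - (s' ⊙ (t ⊙ s ⊙ X + φ e))) (entrySign-opposite st) ⟩
      - (neg (t · q) ⊙ (t ⊙ s ⊙ X + φ e))    ≈⟨ -‿cong (neg-⊙ (t · q) _) ⟩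
      - - ((t · q) ⊙ (t ⊙ s ⊙ X + φ e))      ≈⟨ -‿involutive _ ⟩
      (t · q) ⊙ (t ⊙ s ⊙ X + φ e)            ≡⟨ cong (λ s' → s' ⊙ (t ⊙ s ⊙ X + φ e)) (Sign.*-comm t q) ⟩
      (q · t) ⊙ (t ⊙ s ⊙ X + φ e)            ≈⟨ ⊙-· q t _ ⟩
      q ⊙ t ⊙ (t ⊙ s ⊙ X + φ e)              ≈⟨ *-congˡ (distribˡ ⟦ t ⟧ _ (φ e)) ⟩
      q ⊙ (t ⊙ t ⊙ s ⊙ X + t ⊙ φ e)          ≈⟨ *-congˡ (+-congʳ (⊙-cancel t _)) ⟩
      common                                 ∎

  potential-of-ultraGain : ∀ θ₀ {u w} (W : Walk u w) e t →
    θ₀ ≈ ultraGain W e t → potential θ₀ W ≈ - (t ⊙ φ e)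
  potential-of-ultraGain θ₀ W e t θ₀≈ = begin
    sgn W ⊙ (θ₀ - gain W)                       ≈⟨ *-congˡ (+-congʳ (≈-trans θ₀≈ (+-congˡ (-‿cong (*-signs (φ e) (sgn W) t))))) ⟩
    sgn W ⊙ ((gain W - a) - gain W)             ≈⟨ *-congˡ (xyx⁻¹≈y (gain W) (- a)) ⟩
    sgn W ⊙ - (sgn W ⊙ t ⊙ φ e)                 ≈⟨ ⊙-neg-cancel (sgn W) _ ⟩
    - (t ⊙ φ e)                                 ∎
    where a = sgn W ⊙ t ⊙ φ e

  Nullifies : (Fin n → Carrier) → Subset m → Set ℓ
  Nullifies θ T = ∀ e → e ∈ T → switched θ e ≈ 0#

  endpoints : Ends n → List (Fin n)
  endpoints (twoEnd v _ w _) = v ∷ w ∷ []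
  endpoints (half v _)       = v ∷ []
  endpoints loose            = []

  Incident : Fin m → Fin n → Set
  Incident e v = v ∈ₗ endpoints (ends e)

  incident? : ∀ e v → Dec (Incident e v)
  incident? e v = v ∈?ₗ endpoints (ends e)

  incident-twoEndˡ : ∀ {e v t w t'} → ends e ≡ twoEnd v t w t' → Incident e v
  incident-twoEndˡ eq = subst (λ x → _ ∈ₗ endpoints x) (≡.sym eq) (here refl)

  incident-twoEndʳ : ∀ {e v t w t'} → ends e ≡ twoEnd v t w t' → Incident e w
  incident-twoEndʳ eq = subst (λ x → _ ∈ₗ endpoints x) (≡.sym eq) (there (here refl))

  incident-half : ∀ {e v t} → ends e ≡ half v t → Incident e v
  incident-half eq = subst (λ x → _ ∈ₗ endpoints x) (≡.sym eq) (here refl)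

  half-incident-unique : ∀ {e v t x} → ends e ≡ half v t → Incident e x → x ≡ v
  half-incident-unique eq e∋x with subst (λ y → _ ∈ₗ endpoints y) eq e∋x
  ... | here x≡v = x≡v

  exit-incident : ∀ {e u u'} → Step e u u' → Incident e u
  exit-incident (fwd _ _ eq) = incident-twoEndˡ eq
  exit-incident (bwd _ _ eq) = incident-twoEndʳ eq

  entry-incident : ∀ {e u u'} → Step e u u' → Incident e u'
  entry-incident (fwd _ _ eq) = incident-twoEndʳ eq
  entry-incident (bwd _ _ eq) = incident-twoEndˡ eq

  half? : ∀ e → Dec (∃[ v ] ∃[ t ] ends e ≡ half v t)
  half? e with ends e
  ... | twoEnd _ _ _ _ = no λ { (_ , _ , ()) }
  ... | half v t       = yes (v , t , refl)
  ... | loose          = no λ { (_ , _ , ()) }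

  step-endpoints : ∀ {e u u' x} → Step e u u' → Incident e x → x ≡ u ⊎ x ≡ u'
  step-endpoints (fwd _ _ eq) e∋x with subst (λ y → _ ∈ₗ endpoints y) eq e∋x
  ... | here x≡u = inj₁ x≡u
  ... | there (here x≡u') = inj₂ x≡u'
  step-endpoints (bwd _ _ eq) e∋x with subst (λ y → _ ∈ₗ endpoints y) eq e∋x
  ... | here x≡u' = inj₂ x≡u'
  ... | there (here x≡u) = inj₁ x≡u

  link-entry : ∀ {e a t b t' v} → ends e ≡ twoEnd a t b t' → a ≢ b → Incident e v →
    ∃[ u ] Step e u v × u ≢ v
  link-entry {t = t} {t' = t'} eq a≢b e∋v with subst (λ y → _ ∈ₗ endpoints y) eq e∋v
  ... | here refl         = _ , bwd t' t eq , λ b≡a → a≢b (≡.sym b≡a)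
  ... | there (here refl) = _ , fwd t t' eq , a≢b

  switched-local : ∀ θ θ' e → (∀ v → Incident e v → θ v ≡ θ' v) → switched θ e ≡ switched θ' e
  switched-local θ θ' e agree with ends e
  ... | twoEnd v t w t' = ≡.cong₂ (λ x y → (t ⊙ x + φ e) + t' ⊙ y) (agree v (here refl)) (agree w (there (here refl)))
  ... | half v t = cong (λ x → t ⊙ x + φ e) (agree v (here refl))
  ... | loose = refl

  start∈ : ∀ {u w} (W : Walk u w) → u ∈ₗ verticesOf W
  start∈ []            = here refl
  start∈ (_ ∷⟨ _ ⟩ _) = here refl

  end∈ : ∀ {u w} (W : Walk u w) → w ∈ₗ verticesOf W
  end∈ []            = here refl
  end∈ (_ ∷⟨ _ ⟩ W) = there (end∈ W)

  edge-vertex : ∀ {u w f x} (W : Walk u w) → f ∈ₗ edgesOf W → Incident f x → x ∈ₗ verticesOf W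
  edge-vertex (_ ∷⟨ st ⟩ W) (here refl) f∋x with step-endpoints st f∋x
  ... | inj₁ refl = here refl
  ... | inj₂ refl = there (start∈ W)
  edge-vertex (_ ∷⟨ _ ⟩ W) (there f∈) f∋x = there (edge-vertex W f∈ f∋x)

  path-edges-unique : ∀ {u w} (W : Walk u w) → Unique (verticesOf W) → Unique (edgesOf W)
  path-edges-unique [] _ = []
  path-edges-unique (e ∷⟨ st ⟩ W) (u∉ ∷ W!) =
    All.tabulate (λ f∈ e≡f → All.lookup u∉ (edge-vertex W f∈ (subst (λ f → Incident f _) e≡f (exit-incident st))) refl)
    ∷ path-edges-unique W W!

  prefix : ∀ {u w x} (W : Walk u w) → x ∈ₗ verticesOf W → Walk u x
  prefix []            (here refl) = []
  prefix []            (there ())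
  prefix (_ ∷⟨ _ ⟩ _)  (here refl) = []
  prefix (e ∷⟨ st ⟩ W) (there p)   = e ∷⟨ st ⟩ prefix W p

  suffix : ∀ {u w x} (W : Walk u w) → x ∈ₗ verticesOf W → Walk x w
  suffix []            (here refl) = []
  suffix []            (there ())
  suffix (e ∷⟨ st ⟩ W) (here refl) = e ∷⟨ st ⟩ W
  suffix (_ ∷⟨ _ ⟩ W)  (there p)   = suffix W p

  prefix-⊆ : ∀ {u w x} (W : Walk u w) (p : x ∈ₗ verticesOf W) → verticesOf (prefix W p) ⊆ₗ verticesOf W
  prefix-⊆ []            (here refl) y∈        = y∈
  prefix-⊆ (_ ∷⟨ _ ⟩ _)  (here refl) (here y≡) = here y≡
  prefix-⊆ (_ ∷⟨ _ ⟩ W)  (there p)   (here y≡) = here y≡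
  prefix-⊆ (_ ∷⟨ _ ⟩ W)  (there p)   (there y∈) = there (prefix-⊆ W p y∈)

  prefix-avoids-end : ∀ {u w x} (W : Walk u w) (p : x ∈ₗ verticesOf W) →
    Unique (verticesOf W) → w ∈ₗ verticesOf (prefix W p) → x ≡ w
  prefix-avoids-end []           (here refl) _         _           = refl
  prefix-avoids-end (_ ∷⟨ _ ⟩ _) (here refl) _         (here w≡x)  = ≡.sym w≡x
  prefix-avoids-end (_ ∷⟨ _ ⟩ W) (there p)   (u∉ ∷ _)  (here w≡u)  = ⊥-elim (All.lookup u∉ (end∈ W) (≡.sym w≡u))
  prefix-avoids-end (_ ∷⟨ _ ⟩ W) (there p)   (_ ∷ W!)  (there w∈) = prefix-avoids-end W p W! w∈

  WalkIn-⊆ : ∀ {T T'} → T' ⊆ T → ∀ {u w} (W : Walk u w) → WalkIn T' W → WalkIn T W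
  WalkIn-⊆ T'⊆T []            _          = tt
  WalkIn-⊆ T'⊆T (_ ∷⟨ _ ⟩ W)  (e∈ , wW) = T'⊆T e∈ , WalkIn-⊆ T'⊆T W wW

  IsCycleIn-⊆ : ∀ {T T'} → T' ⊆ T → ∀ {u} (W : Walk u u) → IsCycleIn T' W → IsCycleIn T W
  IsCycleIn-⊆ T'⊆T (e ∷⟨ st ⟩ W) (wW , rest) = WalkIn-⊆ T'⊆T (e ∷⟨ st ⟩ W) wW , rest

  IsPseudoforest-⊆ : ∀ {T T'} → T' ⊆ T → IsPseudoforest T → IsPseudoforest T'
  IsPseudoforest-⊆ T'⊆T (edge-kinds , acyclic , one-half-edge) =
    (λ e e∈ → edge-kinds e (T'⊆T e∈)) ,
    (λ u W cycle → acyclic u W (IsCycleIn-⊆ T'⊆T W cycle)) ,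
    (λ e f v t w t' e∈ f∈ eqe eqf (W , wW) →
       one-half-edge e f v t w t' (T'⊆T e∈) (T'⊆T f∈) eqe eqf (W , WalkIn-⊆ T'⊆T W wW))

  module _ (T : Subset m) where

    WalkIn-∷ʳ : ∀ {u w w' e} (W : Walk u w) (st : Step e w w') → WalkIn T W → e ∈ T → WalkIn T (W ∷ʳ st)
    WalkIn-∷ʳ []            st _          e∈ = e∈ , tt
    WalkIn-∷ʳ (_ ∷⟨ _ ⟩ W)  st (f∈ , wW) e∈ = f∈ , WalkIn-∷ʳ W st wW e∈

    path-∷ʳ : ∀ {u w w' e} (W : Walk u w) (st : Step e w w') →
      IsPathIn T W → e ∈ T → w' ∉ₗ verticesOf W → IsPathIn T (W ∷ʳ st)
    path-∷ʳ W st (wW , W!) e∈ w'∉ =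
      WalkIn-∷ʳ W st wW e∈ ,
      subst Unique (≡.sym (verticesOf-∷ʳ W st)) (Unique-++⁺ W! ([] ∷ []) λ { (w'∈ , here refl) → w'∉ w'∈ })

    prefix-path : ∀ {u w x} (W : Walk u w) (p : x ∈ₗ verticesOf W) → IsPathIn T W → IsPathIn T (prefix W p)
    prefix-path []            (here refl) P             = P
    prefix-path (_ ∷⟨ _ ⟩ _)  (here refl) _             = tt , [] ∷ []
    prefix-path (_ ∷⟨ _ ⟩ W)  (there p)   ((e∈ , wW) , (u∉ ∷ W!)) =
      let wQ , Q! = prefix-path W p (wW , W!)
      in (e∈ , wQ) , (anti-mono (prefix-⊆ W p) u∉ ∷ Q!)

    suffix-path : ∀ {u w x} (W : Walk u w) (p : x ∈ₗ verticesOf W) → IsPathIn T W → IsPathIn T (suffix W p)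
    suffix-path []            (here refl) P                  = P
    suffix-path (_ ∷⟨ _ ⟩ _)  (here refl) P                  = P
    suffix-path (_ ∷⟨ _ ⟩ W)  (there p)   ((_ , wW) , (_ ∷ W!)) = suffix-path W p (wW , W!)

    walk⇒path : ∀ {u w} (W : Walk u w) → WalkIn T W → Σ (Walk u w) (IsPathIn T)
    walk⇒path [] _ = [] , tt , [] ∷ []
    walk⇒path {u} (e ∷⟨ st ⟩ W) (e∈ , wW) with walk⇒path W wW
    ... | Q , wQ , Q! with u ∈?ₗ verticesOf Q
    ...   | yes p  = suffix Q p , suffix-path Q p (wQ , Q!)
    ...   | no u∉ = e ∷⟨ st ⟩ Q , (e∈ , wQ) , (¬Any⇒All¬ _ u∉ ∷ Q!)

    path-across-link : ∀ {r a t b t' e} (P : Walk r a) → IsPathIn T P → e ∈ T →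
      ends e ≡ twoEnd a t b t' → a ≢ b →
      ∃[ x ] ∃[ y ] Σ (Walk r x) λ Q → Σ (Step e x y) λ st → IsPathIn T Q × IsPathIn T (Q ∷ʳ st)
    path-across-link {b = b} P pP e∈ eq a≢b with b ∈?ₗ verticesOf P
    ... | no b∉ = _ , _ , P , fwd _ _ eq , pP , path-∷ʳ P (fwd _ _ eq) pP e∈ b∉
    ... | yes p = _ , _ , Q , bwd _ _ eq , pQ , path-∷ʳ Q (bwd _ _ eq) pQ e∈ a∉
      where
      Q = prefix P p
      pQ = prefix-path P p pP
      a∉ : _ ∉ₗ verticesOf Q
      a∉ a∈ = a≢b (≡.sym (prefix-avoids-end P p (proj₂ pP) a∈))

    closing-cycle : ∀ {u w f} (st : Step f w u) (W : Walk u w) → f ∈ T → IsPathIn T W → f ∉ₗ edgesOf W →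
      IsCycleIn T (f ∷⟨ st ⟩ W)
    closing-cycle st W f∈ (wW , W!) f∉ = (f∈ , wW) , (¬Any⇒All¬ _ f∉ ∷ path-edges-unique W W!) , W!

    connected⇒path : Connected T → ∀ {u v} → VertexOf T u → VertexOf T v → Σ (Walk u v) (IsPathIn T)
    connected⇒path conn u∈ v∈ = let W , wW = conn _ _ u∈ v∈ in walk⇒path W wW

    potential-nullifies : IsPseudoforest T → Connected T → ∀ r → VertexOf T r → ∀ θ₀ →
      (∀ e w t → e ∈ T → ends e ≡ half w t → (P : Walk r w) → IsPathIn T P → θ₀ ≈ ultraGain P e t) →
      ∀ θ → (∀ v (P : Walk r v) → IsPathIn T P → θ v ≈ potential θ₀ P) → Nullifies θ T
    potential-nullifies pf conn _ r∈ θ₀ θ₀-ultra θ θ-potential e e∈ with proj₁ pf e e∈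
    ... | inj₂ (w , t , eq) =
      let P , pP = connected⇒path conn r∈ (e , e∈ , inj₂ (inj₂ (t , eq)))
      in vanishes-at-half θ eq (≈-trans (θ-potential w P pP) (potential-of-ultraGain θ₀ P e t (θ₀-ultra e w t e∈ eq P pP)))
    ... | inj₁ (_ , t , b , t' , eq , a≢b) =
      let P , pP = connected⇒path conn r∈ (e , e∈ , inj₁ (t , b , t' , eq))
          x , y , Q , st , pQ , pQst = path-across-link P pP e∈ eq a≢b
      in vanishes-across θ st (begin
        θ y                                                      ≈⟨ θ-potential y (Q ∷ʳ st) pQst ⟩
        potential θ₀ (Q ∷ʳ st)                                   ≈⟨ potential-∷ʳ θ₀ Q st ⟩
        - (entrySign st ⊙ (exitSign st ⊙ potential θ₀ Q + φ e))  ≈⟨ -‿cong (*-congˡ (+-congʳ (*-congˡ (θ-potential x Q pQ)))) ⟨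
        - (entrySign st ⊙ (exitSign st ⊙ θ x + φ e))             ∎)

    Leaf : Fin m → Fin n → Set
    Leaf e v = e ∈ T × Incident e v × (∀ f → f ∈ T → Incident f v → f ≡ e)

    Branching : Set
    Branching = ∀ e v → e ∈ T → Incident e v → ∃[ f ] f ∈ T × Incident f v × f ≢ e

    leaf? : ∀ e v → Dec (Leaf e v)
    leaf? e v = (e ∈? T) ×-dec incident? e v ×-dec all? λ f → (f ∈? T) →-dec (incident? f v →-dec (f ≟ e))

    leaf-or-branching : ∃₂ Leaf ⊎ Branching
    leaf-or-branching with any? (λ e → any? (λ v → leaf? e v))
    ... | yes (e , v , leaf) = inj₁ (e , v , leaf)
    ... | no no-leaf = inj₂ λ e v e∈ e∋v → decidable-stable (other? e v) λ no-other →
      no-leaf (e , v , e∈ , e∋v , λ f f∈ f∋v → decidable-stable (f ≟ e) λ f≢e → no-other (f , f∈ , f∋v , f≢e))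
      where
      other? : ∀ e v → Dec (∃[ f ] f ∈ T × Incident f v × f ≢ e)
      other? e v = any? λ f → (f ∈? T) ×-dec incident? f v ×-dec ¬? (f ≟ e)

    module _ (pf : IsPseudoforest T) (branching : Branching) where

      HalfEdgesReachableOnlyAt : Fin n → Set
      HalfEdgesReachableOnlyAt s = ∀ f x t → f ∈ T → ends f ≡ half x t → ∃[ W ] WalkIn T {x} {s} W → x ≡ s

      branching-link : ∀ {e u} → e ∈ T → Incident e u → (∀ f t → f ∈ T → ends f ≡ half u t → f ≡ e) →
        ∃[ f ] ∃[ u″ ] f ∈ T × f ≢ e × Step f u″ u × u″ ≢ u
      branching-link e∈ e∋u only-e with branching _ _ e∈ e∋u
      ... | f , f∈ , f∋u , f≢e with proj₁ pf f f∈
      ...   | inj₁ (_ , _ , _ , _ , eq , a≢b) =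
        let u″ , st , u″≢u = link-entry eq a≢b f∋u in f , u″ , f∈ , f≢e , st , u″≢u
      ...   | inj₂ (x , t , eq) with half-incident-unique eq f∋u
      ...     | refl = ⊥-elim (f≢e (only-e f t f∈ eq))

      -- The fuel k runs out before the path exceeds n vertices, which is impossible for a path.
      grow : ∀ k {u u' s e} (st : Step e u u') (P : Walk u' s) → IsPathIn T (e ∷⟨ st ⟩ P) →
        HalfEdgesReachableOnlyAt s → n < L.length (verticesOf (e ∷⟨ st ⟩ P)) ℕ.+ k → ⊥
      grow zero st P pP _ long = ℕ.<⇒≱ (subst (n <_) (ℕ.+-identityʳ _) long) (unique⇒length≤ (proj₂ pP))
      grow (suc k) {u} {e = e} st P pP@((e∈ , _) , (u∉ ∷ _)) only-at-s long
        with branching-link e∈ (exit-incident st)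
               (λ f t f∈ eq → ⊥-elim (All.lookup u∉ (end∈ P) (only-at-s f u t f∈ eq (e ∷⟨ st ⟩ P , proj₁ pP))))
      ... | f , u″ , f∈ , f≢e , st′ , u″≢u with u″ ∈?ₗ verticesOf P
      ...   | yes q = proj₁ (proj₂ pf) u″ (f ∷⟨ st′ ⟩ W)
                       (closing-cycle st′ W f∈ (prefix-path (e ∷⟨ st ⟩ P) (there q) pP) f∉)
        where
        W = e ∷⟨ st ⟩ prefix P q
        f∉ : f ∉ₗ edgesOf W
        f∉ (here f≡e)  = f≢e f≡e
        f∉ (there f∈W) = All.lookup u∉ (prefix-⊆ P q (edge-vertex (prefix P q) f∈W (entry-incident st′))) refl
      ...   | no u″∉ = grow k st′ (e ∷⟨ st ⟩ P) ((f∈ , proj₁ pP) , ((u″≢u ∷ ¬Any⇒All¬ _ u″∉) ∷ proj₂ pP))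
                         only-at-s (subst (n <_) (cong suc (ℕ.+-suc _ k)) long)

      branching-absurd : ∀ e → e ∈ T → ⊥
      branching-absurd e e∈ with any? (λ h → (h ∈? T) ×-dec half? h)
      ... | yes (h , h∈ , s , th , eqh) =
        let f , u , f∈ , _ , st , u≢s = branching-link h∈ (incident-half eqh)
              (λ f t f∈ eqf → ≡.sym (one-half-edge h f s th s t h∈ f∈ eqh eqf ([] , tt)))
        in grow n st [] ((f∈ , tt) , ((u≢s ∷ []) ∷ [] ∷ [])) only-at-s (ℕ.n≤1+n _)
        where
        one-half-edge = proj₂ (proj₂ pf)
        only-at-s : HalfEdgesReachableOnlyAt s
        only-at-s g x t g∈ eqg W with one-half-edge g h x t s th g∈ h∈ eqg eqh W
        ... | refl = half-incident-unique eqh (incident-half eqg)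
      ... | no no-half with proj₁ pf e e∈
      ...   | inj₁ (_ , t , _ , t' , eq , a≢b) =
        grow n (fwd t t' eq) [] ((e∈ , tt) , ((a≢b ∷ []) ∷ [] ∷ []))
          (λ f x t f∈ eqf _ → ⊥-elim (no-half (f , f∈ , x , t , eqf))) (ℕ.n≤1+n _)
      ...   | inj₂ e-half = ⊥-elim (no-half (e , e∈ , e-half))

  extend-over-leaf : ∀ {T e v θ} → Leaf T e v → Nullifies θ (T ∖ e) → ∀ c →
    switched (updateAt θ v (const c)) e ≈ 0# → Nullifies (updateAt θ v (const c)) T
  extend-over-leaf {e = e} {v} {θ} (_ , _ , only-e) θ-null c e-vanishes f f∈ with f ≟ e
  ... | yes refl = e-vanishes
  ... | no f≢e = ≈-trans (reflexive (switched-local _ θ f unchanged)) (θ-null f (x∈p∧x≢y⇒x∈p-y f∈ f≢e))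
    where
    unchanged : ∀ x → Incident f x → updateAt θ v (const c) x ≡ θ x
    unchanged x f∋x = updateAt-minimal x v θ λ x≡v → f≢e (only-e f f∈ (subst (Incident f) x≡v f∋x))

  remove-leaf : ∀ {T e v} → IsPseudoforest T → Leaf T e v → ∃[ θ ] Nullifies θ (T ∖ e) → ∃[ θ ] Nullifies θ T
  remove-leaf {e = e} {v} pf leaf@(e∈ , e∋v , _) (θ , θ-null) with proj₁ pf e e∈
  ... | inj₁ (_ , _ , _ , _ , eq , a≢b) =
    let u , st , u≢v = link-entry eq a≢b e∋v
        value-at-v : Carrier → Carrier
        value-at-v y = - (entrySign st ⊙ (exitSign st ⊙ y + φ e))
    in _ , extend-over-leaf leaf θ-null (value-at-v (θ u))
             (vanishes-across _ st (reflexive (≡.trans (updateAt-updates v θ)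
               (cong value-at-v (≡.sym (updateAt-minimal u v θ u≢v))))))
  ... | inj₂ (x , t , eq) with half-incident-unique eq e∋v
  ...   | refl = _ , extend-over-leaf leaf θ-null (- (t ⊙ φ e)) (vanishes-at-half _ eq (reflexive (updateAt-updates v θ)))

  nullifier-exists : ∀ k T → ∣ T ∣ < k → IsPseudoforest T → ∃[ θ ] Nullifies θ T
  nullifier-exists (suc k) T (s≤s ∣T∣≤k) pf with leaf-or-branching T
  ... | inj₁ (e , v , leaf) =
    remove-leaf pf leaf (nullifier-exists k (T ∖ e) (ℕ.<-≤-trans (x∈p⇒∣p-x∣<∣p∣ (proj₁ leaf)) ∣T∣≤k)
                                        (IsPseudoforest-⊆ (p─q⊆p T ⁅ e ⁆) pf))
  ... | inj₂ branching = const 0# , λ e e∈ → ⊥-elim (branching-absurd T pf branching e e∈)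

lemma2p12 : ∀ {c ℓ} (F : Field c ℓ) → CharNot2 F →
  ∀ {n m : ℕ} (G : GainSignedGraph F n m) (T : Subset m) →
  let open Field F
      open GSG G
      open GainSignedGraph G using (ends)
  in IsPseudoforest T →
     (∃[ θ ] (∀ e → e ∈ T → switched θ e ≈ 0#))
     × (Connected T → (r : Fin n) → VertexOf T r → (θ₀ : Carrier) →
        (∀ e w t → e ∈ T → ends e ≡ half w t →
           (P : Walk r w) → IsPathIn T P → θ₀ ≈ ultraGain P e t) →
        (θ : Fin n → Carrier) →
        (∀ v (P : Walk r v) → IsPathIn T P → θ v ≈ ⟦ sgn P ⟧ * (θ₀ - gain P)) →
        ∀ e → e ∈ T → switched θ e ≈ 0#)
lemma2p12 F _ {m = m} G T pf =
  nullifier-exists (suc m) T (s≤s (∣p∣≤n T)) pf , potential-nullifies T pf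
  where open GainSwitching G
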